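{- For every $n\ge1$, the number of irreducible supermodular functions $f\colon 2^{[n]}\to\mathbb{R}$, up to equivalence, is at most $\binom{n^22^n}{2^n}$.
   Context: A function $f\colon 2^{[n]}\to\mathbb{R}$ is supermodular if $f(I\cap J)+f(I\cup J)\ge f(I)+f(J)$ for all $I,J\subseteq[n]$, and modular if equality always holds. Two supermodular functions are equivalent if they differ by a modular function. A supermodular function $f$ is irreducible if it is not modular and whenever $f=g_1+g_2$ with $g_1,g_2$ supermodular, each $g_i$ is equivalent to $c_if$ for some $c_i\ge0$. Irreducible functions are counted up to equivalence and positive scaling ($f$ and $g$ identified if $g-cf$ is modular for some $c>0$). -}

module Defs where

open import Level using (0ℓ)
open import Data.Nat using (ℕ)
open import Data.Product using (∃; _×_; Σ)
open import Relation.Nullary using (¬_)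
open import Algebra.Bundles using (CommutativeRing)
open import Relation.Binary.Structures using (IsTotalOrder)
open import Data.Fin.Subset using (Subset; _∩_; _∪_)

-- An ordered field (the reals ℝ are one). Equality is the setoid equality _≈_.
record OrderedField : Set₁ where
  field
    commutativeRing : CommutativeRing 0ℓ 0ℓ
  open CommutativeRing commutativeRing public
  field
    _≤_           : Carrier → Carrier → Set
    ≤-isTotalOrder : IsTotalOrder _≈_ _≤_
    +-monoˡ-≤     : ∀ {x y} z → x ≤ y → (x + z) ≤ (y + z)
    *-nonneg      : ∀ {x y} → 0# ≤ x → 0# ≤ y → 0# ≤ (x * y)
    0≉1           : ¬ (0# ≈ 1#)
    inverse       : ∀ x → ¬ (x ≈ 0#) → ∃ λ y → (x * y) ≈ 1#

  _<_ : Carrier → Carrier → Set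
  x < y = (x ≤ y) × ¬ (x ≈ y)

module _ (F : OrderedField) where
  open OrderedField F

  SetFun : ℕ → Set
  SetFun n = Subset n → Carrier

  Supermodular : ∀ {n} → SetFun n → Set
  Supermodular f = ∀ I J → (f I + f J) ≤ (f (I ∩ J) + f (I ∪ J))

  Modular : ∀ {n} → SetFun n → Set
  Modular f = ∀ I J → (f (I ∩ J) + f (I ∪ J)) ≈ (f I + f J)

  Equivalent : ∀ {n} → SetFun n → SetFun n → Set
  Equivalent f g = Modular (λ I → f I - g I)

  Irreducible : ∀ {n} → SetFun n → Set
  Irreducible f =
    Supermodular f × ¬ Modular f ×
    (∀ g₁ g₂ → Supermodular g₁ → Supermodular g₂ → (∀ I → f I ≈ (g₁ I + g₂ I)) →
       (∃ λ c₁ → (0# ≤ c₁) × Equivalent g₁ (λ I → c₁ * f I)) ×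
       (∃ λ c₂ → (0# ≤ c₂) × Equivalent g₂ (λ I → c₂ * f I)))

  Identified : ∀ {n} → SetFun n → SetFun n → Set
  Identified f g = ∃ λ c → (0# < c) × Modular (λ I → g I - (c * f I))

{-# OPTIONS --safe #-}
-- Supermodularity is equivalent to the nonnegativity of the defects
-- f(A) + f(A ∪ {i,j}) - f(A ∪ {i}) - f(A ∪ {j}) of the m local squares of the cube, and these
-- defects are linear functionals on the 2ⁿ-dimensional space of set functions.  For an
-- irreducible f, Gaussian elimination selects a set B of at most 2ⁿ squares at which f is tight
-- such that any set function tight on B is tight wherever f is.  If irreducible f and g share
-- such a B they are tight at the same squares, so f - ρg stays supermodular for some ρ > 0.
-- Irreducibility of f, applied to f = (f - ρg) + ρg, makes ρg equivalent to c·f, and c ≠ 0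
-- because g is not modular: f and g are identified.  So pairwise non-identified irreducible
-- functions have distinct sets B, of which there are at most (m + 2ⁿ choose 2ⁿ), and
-- m + 2ⁿ ≤ n²2ⁿ.  Equality in an ordered field is undecidable, so the eliminations are
-- carried out under double negation, which the decidable conclusion absorbs.
module Submission where

open import Level using (0ℓ)
open import Function using (_∘_)
open import Data.Nat as ℕ using (ℕ; zero; suc)
import Data.Nat.Properties as ℕ
open import Data.Integer as ℤ using (ℤ; 0ℤ)
open import Data.Fin using (Fin; zero; suc)
open import Data.Fin.Subset using (Subset; outside; inside; _∈_; ∣_∣; ⁅_⁆; _∪_; _∩_; ⊥)
open import Data.Product as Product using (∃; _×_; _,_; proj₁; proj₂)
open import Data.Sum using (inj₁; inj₂; [_,_]′)
open import Relation.Binary.PropositionalEquality as ≡ using (_≡_; _≢_)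
open import Relation.Binary.Structures using (IsTotalOrder)
open import Relation.Nullary using (¬_; Dec; yes; no)
open import Relation.Nullary.Decidable using (¬¬-excluded-middle; _×-dec_; ¬?; decidable-stable)
open import Relation.Nullary.Negation using (¬¬-Monad; contradiction)
open import Effect.Monad using (RawMonad)
open import Algebra.Bundles using (CommutativeRing)
open import Defs

open RawMonad (¬¬-Monad {0ℓ}) using (pure; _>>=_; _<$>_)

¬¬-decide : ∀ {m} (P : Fin m → Set) → ¬ ¬ (∀ i → Dec (P i))
¬¬-decide {zero} P = pure λ ()
¬¬-decide {suc m} P = do
  d₀ ← ¬¬-excluded-middle
  ds ← ¬¬-decide (P ∘ suc)
  pure λ { zero → d₀ ; (suc i) → ds i }

module _ {A B : Set} {R : A → B → Set} where
  open import Data.List using ([]; _∷_)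
  open import Data.List.Relation.Unary.All using (All; []; _∷_)
  open import Data.List.Relation.Unary.AllPairs using (AllPairs; []; _∷_)
  open import Data.List.Relation.Unary.Unique.Propositional using (Unique)
  open import Data.List.Relation.Binary.Pointwise using (Pointwise; []; _∷_)

  ¬¬-Pointwise : ∀ {P : A → Set} {xs} → (∀ {x} → P x → ¬ ¬ ∃ (R x)) → All P xs →
    ¬ ¬ ∃ (Pointwise R xs)
  ¬¬-Pointwise R-total [] = pure ([] , [])
  ¬¬-Pointwise R-total (px ∷ pxs) = do
    (y , rxy) ← R-total px
    (ys , rs) ← ¬¬-Pointwise R-total pxs
    pure (y ∷ ys , rxy ∷ rs)

  Pointwise⇒All : ∀ {P : B → Set} {xs ys} → (∀ {x y} → R x y → P y) → Pointwise R xs ys → All P ys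
  Pointwise⇒All R⇒P [] = []
  Pointwise⇒All R⇒P (rxy ∷ rs) = R⇒P rxy ∷ Pointwise⇒All R⇒P rs

  module _ {S : A → A → Set} (R-injective : ∀ {x x′ y} → R x y → R x′ y → ¬ ¬ S x x′) where
    Pointwise-distinct : ∀ {x y xs ys} → R x y → All (λ x′ → ¬ S x x′) xs → Pointwise R xs ys →
      All (y ≢_) ys
    Pointwise-distinct rxy [] [] = []
    Pointwise-distinct rxy (¬Sxx′ ∷ ¬Ss) (rx′y′ ∷ rs) =
      (λ { ≡.refl → R-injective rxy rx′y′ ¬Sxx′ }) ∷ Pointwise-distinct rxy ¬Ss rs

    Pointwise-unique : ∀ {xs ys} → AllPairs (λ x x′ → ¬ S x x′) xs → Pointwise R xs ys → Unique ys
    Pointwise-unique [] [] = []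
    Pointwise-unique (¬Ss ∷ ¬Sss) (rxy ∷ rs) = Pointwise-distinct rxy ¬Ss rs ∷ Pointwise-unique ¬Sss rs

module ℤ-Homomorphism {c ℓ} (R : CommutativeRing c ℓ) where
  open import Data.Integer using (+_; -[1+_]; _⊖_)
  import Data.Integer.Properties as ℤ
  open import Data.Maybe using (Maybe; just; nothing)
  open import Algebra.Solver.Ring.AlmostCommutativeRing
    using (fromCommutativeRing; _-Raw-AlmostCommutative⟶_)
  open CommutativeRing R
  open import Algebra.Properties.Ring ring
    using (-‿involutive; -0#≈0#; -‿distribˡ-*; -‿distribʳ-*)
  open import Algebra.Properties.AbelianGroup +-abelianGroup using (⁻¹-∙-comm)
  open import Algebra.Properties.CommutativeSemigroup +-commutativeSemigroup using (interchange)
  import Algebra.Properties.Semiring.Mult semiring as Mult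
  open import Relation.Binary.Reasoning.Setoid setoid

  fromℕ : ℕ → Carrier
  fromℕ n = n Mult.× 1#

  ⟦_⟧ℤ : ℤ → Carrier
  ⟦ + n ⟧ℤ = fromℕ n
  ⟦ -[1+ n ] ⟧ℤ = - fromℕ (suc n)

  -‿distrib-+ : ∀ a b → - (a + b) ≈ - a - b
  -‿distrib-+ a b = sym (⁻¹-∙-comm a b)

  -‿homo : ∀ i → ⟦ ℤ.- i ⟧ℤ ≈ - ⟦ i ⟧ℤ
  -‿homo -[1+ n ] = sym (-‿involutive _)
  -‿homo (+ zero) = sym -0#≈0#
  -‿homo (+ suc n) = refl

  ⊖-homo : ∀ m n → ⟦ m ⊖ n ⟧ℤ ≈ fromℕ m - fromℕ n
  ⊖-homo m zero = sym (trans (+-congˡ -0#≈0#) (+-identityʳ _))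
  ⊖-homo zero (suc n) = sym (+-identityˡ _)
  ⊖-homo (suc m) (suc n) = begin
    ⟦ suc m ⊖ suc n ⟧ℤ               ≡⟨ ≡.cong ⟦_⟧ℤ (ℤ.[1+m]⊖[1+n]≡m⊖n m n) ⟩
    ⟦ m ⊖ n ⟧ℤ                       ≈⟨ ⊖-homo m n ⟩
    fromℕ m - fromℕ n                ≈⟨ +-identityˡ _ ⟨
    0# + (fromℕ m - fromℕ n)         ≈⟨ +-congʳ (-‿inverseʳ 1#) ⟨
    (1# - 1#) + (fromℕ m - fromℕ n)  ≈⟨ interchange 1# (- 1#) (fromℕ m) (- fromℕ n) ⟩
    (1# + fromℕ m) + (- 1# - fromℕ n) ≈⟨ +-congˡ (-‿distrib-+ 1# (fromℕ n)) ⟨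
    (1# + fromℕ m) - (1# + fromℕ n)  ∎

  +-homo : ∀ i j → ⟦ i ℤ.+ j ⟧ℤ ≈ ⟦ i ⟧ℤ + ⟦ j ⟧ℤ
  +-homo -[1+ m ] -[1+ n ] = begin
    - fromℕ (suc (suc (m ℕ.+ n)))     ≡⟨ ≡.cong (λ k → - fromℕ k) (ℕ.+-suc (suc m) n) ⟨
    - fromℕ (suc m ℕ.+ suc n)         ≈⟨ -‿cong (Mult.×-homo-+ 1# (suc m) (suc n)) ⟩
    - (fromℕ (suc m) + fromℕ (suc n)) ≈⟨ -‿distrib-+ _ _ ⟩
    - fromℕ (suc m) - fromℕ (suc n)   ∎
  +-homo -[1+ m ] (+ n) = trans (⊖-homo n (suc m)) (+-comm _ _)
  +-homo (+ m) -[1+ n ] = ⊖-homo m (suc n)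
  +-homo (+ m) (+ n) = Mult.×-homo-+ 1# m n

  *-homo-nonneg : ∀ i n → ⟦ i ℤ.* + n ⟧ℤ ≈ ⟦ i ⟧ℤ * fromℕ n
  *-homo-nonneg (+ m) n = trans (reflexive (≡.cong ⟦_⟧ℤ (≡.sym (ℤ.pos-* m n)))) (Mult.×1-homo-* m n)
  *-homo-nonneg -[1+ m ] n = begin
    ⟦ -[1+ m ] ℤ.* + n ⟧ℤ       ≡⟨ ≡.cong ⟦_⟧ℤ (ℤ.neg-distribˡ-* (+ suc m) (+ n)) ⟨
    ⟦ ℤ.- (+ suc m ℤ.* + n) ⟧ℤ  ≈⟨ -‿homo (+ suc m ℤ.* + n) ⟩
    - ⟦ + suc m ℤ.* + n ⟧ℤ      ≈⟨ -‿cong (*-homo-nonneg (+ suc m) n) ⟩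
    - (fromℕ (suc m) * fromℕ n) ≈⟨ -‿distribˡ-* _ _ ⟩
    - fromℕ (suc m) * fromℕ n   ∎

  *-homo : ∀ i j → ⟦ i ℤ.* j ⟧ℤ ≈ ⟦ i ⟧ℤ * ⟦ j ⟧ℤ
  *-homo i (+ n) = *-homo-nonneg i n
  *-homo i -[1+ n ] = begin
    ⟦ i ℤ.* -[1+ n ] ⟧ℤ         ≡⟨ ≡.cong ⟦_⟧ℤ (ℤ.neg-distribʳ-* i (+ suc n)) ⟨
    ⟦ ℤ.- (i ℤ.* + suc n) ⟧ℤ    ≈⟨ -‿homo (i ℤ.* + suc n) ⟩
    - ⟦ i ℤ.* + suc n ⟧ℤ        ≈⟨ -‿cong (*-homo-nonneg i (suc n)) ⟩
    - (⟦ i ⟧ℤ * fromℕ (suc n))  ≈⟨ -‿distribʳ-* _ _ ⟩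
    ⟦ i ⟧ℤ * - fromℕ (suc n)    ∎

  ℤ⟶R : ℤ.+-*-rawRing -Raw-AlmostCommutative⟶ fromCommutativeRing R
  ℤ⟶R = record
    { ⟦_⟧ = ⟦_⟧ℤ ; +-homo = +-homo ; *-homo = *-homo ; -‿homo = -‿homo
    ; 0-homo = refl ; 1-homo = +-identityʳ 1#
    }

  ⟦⟧ℤ-≟ : ∀ i j → Maybe (⟦ i ⟧ℤ ≈ ⟦ j ⟧ℤ)
  ⟦⟧ℤ-≟ i j with i ℤ.≟ j
  ... | yes ≡.refl = just refl
  ... | no _ = nothing

-- Integer coefficients have decidable equality, so normal forms over them are compared by
-- evaluation; the canonical map ℤ → R makes this solver available in every commutative ring.
module ℤ-RingSolver {c ℓ} (R : CommutativeRing c ℓ) where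
  open import Algebra.Solver.Ring.AlmostCommutativeRing using (fromCommutativeRing)
  open ℤ-Homomorphism R using (ℤ⟶R; ⟦⟧ℤ-≟)
  open import Algebra.Solver.Ring ℤ.+-*-rawRing (fromCommutativeRing R) ℤ⟶R ⟦⟧ℤ-≟ public

module OrderedFieldProperties (F : OrderedField) where
  open OrderedField F hiding (zero)
  open ℤ-RingSolver commutativeRing
  open import Algebra.Properties.Ring ring using (-‿distribʳ-*)
  open import Relation.Binary.Reasoning.Setoid setoid
  private module ≤ = IsTotalOrder ≤-isTotalOrder

  ≤-respˡʳ-≈ : ∀ {x x′ y y′} → x ≈ x′ → y ≈ y′ → x ≤ y → x′ ≤ y′
  ≤-respˡʳ-≈ x≈x′ y≈y′ x≤y = ≤.trans (≤.reflexive (sym x≈x′)) (≤.trans x≤y (≤.reflexive y≈y′))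

  +-mono-≤ : ∀ {a b c d} → a ≤ b → c ≤ d → (a + c) ≤ (b + d)
  +-mono-≤ {a} {b} {c} {d} a≤b c≤d =
    ≤.trans (+-monoˡ-≤ c a≤b) (≤-respˡʳ-≈ (+-comm c b) (+-comm d b) (+-monoˡ-≤ b c≤d))

  x≤y⇒0≤y-x : ∀ {x y} → x ≤ y → 0# ≤ (y - x)
  x≤y⇒0≤y-x {x} x≤y = ≤-respˡʳ-≈ (-‿inverseʳ x) refl (+-monoˡ-≤ (- x) x≤y)

  0≤y-x⇒x≤y : ∀ {x y} → 0# ≤ (y - x) → x ≤ y
  0≤y-x⇒x≤y {x} {y} 0≤y-x = ≤-respˡʳ-≈ (+-identityˡ x)
    (solve 2 (λ x y → (y :- x) :+ x := y) refl x y) (+-monoˡ-≤ x 0≤y-x)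

  *-monoʳ-≤ : ∀ {x y z} → 0# ≤ z → x ≤ y → (x * z) ≤ (y * z)
  *-monoʳ-≤ {x} {y} {z} 0≤z x≤y = 0≤y-x⇒x≤y (≤-respˡʳ-≈ refl
    (solve 3 (λ x y z → (y :- x) :* z := y :* z :- x :* z) refl x y z)
    (*-nonneg (x≤y⇒0≤y-x x≤y) 0≤z))

  ≤-exchange : ∀ {a b c d a′ d′} → (a + b) ≤ (c + d) → (a′ - a) ≤ (d′ - d) → (a′ + b) ≤ (c + d′)
  ≤-exchange {a} {b} {c} {d} {a′} {d′} ab≤cd Δa≤Δd = ≤-respˡʳ-≈
    (solve 3 (λ a b a′ → (a :+ b) :+ (a′ :- a) := a′ :+ b) refl a b a′)
    (solve 3 (λ c d d′ → (c :+ d) :+ (d′ :- d) := c :+ d′) refl c d d′)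
    (+-mono-≤ ab≤cd Δa≤Δd)

  x≤0⇒0≤-x : ∀ {x} → x ≤ 0# → 0# ≤ (- x)
  x≤0⇒0≤-x {x} x≤0 = ≤-respˡʳ-≈ (-‿inverseʳ x) (+-identityˡ (- x)) (+-monoˡ-≤ (- x) x≤0)

  0≤1 : 0# ≤ 1#
  0≤1 with ≤.total 0# 1#
  ... | inj₁ 0≤1 = 0≤1
  ... | inj₂ 1≤0 = ≤-respˡʳ-≈ refl
    (trans (solve 1 (λ a → :- a :* :- a := a :* a) refl 1#) (*-identityˡ 1#))
    (*-nonneg (x≤0⇒0≤-x 1≤0) (x≤0⇒0≤-x 1≤0))

  0<1 : 0# < 1#
  0<1 = 0≤1 , 0≉1

  inverse-nonneg : ∀ {x y} → 0# ≤ x → (x * y) ≈ 1# → 0# ≤ y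
  inverse-nonneg {x} {y} 0≤x xy≈1 with ≤.total 0# y
  ... | inj₁ 0≤y = 0≤y
  ... | inj₂ y≤0 = contradiction (≤.antisym 0≤1 1≤0) 0≉1
    where
    0≤-1 : 0# ≤ (- 1#)
    0≤-1 = ≤-respˡʳ-≈ refl (trans (sym (-‿distribʳ-* x y)) (-‿cong xy≈1))
      (*-nonneg 0≤x (x≤0⇒0≤-x y≤0))
    1≤0 : 1# ≤ 0#
    1≤0 = 0≤y-x⇒x≤y (≤-respˡʳ-≈ refl (sym (+-identityˡ (- 1#))) 0≤-1)

  0<x⇒x≉0 : ∀ {x} → 0# < x → ¬ x ≈ 0#
  0<x⇒x≉0 (_ , 0≉x) x≈0 = 0≉x (sym x≈0)

  inverse-pos : ∀ {x y} → 0# < x → (x * y) ≈ 1# → 0# < y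
  inverse-pos {x} {y} (0≤x , _) xy≈1 = inverse-nonneg 0≤x xy≈1 , λ 0≈y →
    0≉1 (trans (sym (zeroʳ x)) (trans (*-congˡ 0≈y) xy≈1))

  *-pos : ∀ {x y} → 0# < x → 0# < y → 0# < (x * y)
  *-pos {x} {y} (0≤x , 0≉x) 0<y@(0≤y , 0≉y) = *-nonneg 0≤x 0≤y , λ 0≈xy →
    0≉x (begin
      0#            ≈⟨ zeroˡ y⁻¹ ⟨
      0# * y⁻¹      ≈⟨ *-congʳ 0≈xy ⟩
      (x * y) * y⁻¹ ≈⟨ *-assoc x y y⁻¹ ⟩
      x * (y * y⁻¹) ≈⟨ *-congˡ yy⁻¹≈1 ⟩
      x * 1#        ≈⟨ *-identityʳ x ⟩
      x             ∎)
    where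
    y⁻¹ = proj₁ (inverse y (0<x⇒x≉0 0<y))
    yy⁻¹≈1 = proj₂ (inverse y (0<x⇒x≉0 0<y))

  positive-lower-bound : ∀ {m} (t : Fin m → Carrier) → (∀ k → 0# < t k) →
    ∃ λ ρ → 0# < ρ × (∀ k → ρ ≤ t k)
  positive-lower-bound {zero} t _ = 1# , 0<1 , λ ()
  positive-lower-bound {suc m} t 0<t with positive-lower-bound (t ∘ suc) (0<t ∘ suc)
  ... | ρ , 0<ρ , ρ≤t with ≤.total (t zero) ρ
  ...   | inj₁ t₀≤ρ = t zero , 0<t zero , λ { zero → ≤.refl ; (suc k) → ≤.trans t₀≤ρ (ρ≤t k) }
  ...   | inj₂ ρ≤t₀ = ρ , 0<ρ , λ { zero → ρ≤t₀ ; (suc k) → ρ≤t k }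

  positive-ratio-below : ∀ {a b} → 0# ≤ a → 0# ≤ b → (a ≈ 0# → b ≈ 0#) → Dec (b ≈ 0#) →
    ∃ λ t → 0# < t × ((t * b) ≤ a)
  positive-ratio-below {a} {b} 0≤a _ _ (yes b≈0) =
    1# , 0<1 , ≤-respˡʳ-≈ (trans (sym (zeroʳ 1#)) (*-congˡ (sym b≈0))) refl 0≤a
  positive-ratio-below {a} {b} 0≤a 0≤b a≈0⇒b≈0 (no b≉0) =
    a * b⁻¹ , *-pos 0<a (inverse-pos 0<b bb⁻¹≈1) , ≤.reflexive (begin
      (a * b⁻¹) * b ≈⟨ *-assoc a b⁻¹ b ⟩
      a * (b⁻¹ * b) ≈⟨ *-congˡ (trans (*-comm b⁻¹ b) bb⁻¹≈1) ⟩
      a * 1#        ≈⟨ *-identityʳ a ⟩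
      a             ∎)
    where
    0<a : 0# < a
    0<a = 0≤a , λ 0≈a → b≉0 (a≈0⇒b≈0 (sym 0≈a))
    0<b : 0# < b
    0<b = 0≤b , b≉0 ∘ sym
    b⁻¹ = proj₁ (inverse b b≉0)
    bb⁻¹≈1 = proj₂ (inverse b b≉0)

  ¬¬-common-ratio-below : ∀ {m} (a b : Fin m → Carrier) → (∀ k → 0# ≤ a k) → (∀ k → 0# ≤ b k) →
    (∀ k → a k ≈ 0# → b k ≈ 0#) → ¬ ¬ (∃ λ ρ → 0# < ρ × (∀ k → (ρ * b k) ≤ a k))
  ¬¬-common-ratio-below a b 0≤a 0≤b a≈0⇒b≈0 = do
    b≟0 ← ¬¬-decide (λ k → b k ≈ 0#)
    let ratio k = positive-ratio-below (0≤a k) (0≤b k) (a≈0⇒b≈0 k) (b≟0 k)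
        (ρ , 0<ρ , ρ≤t) = positive-lower-bound (proj₁ ∘ ratio) (proj₁ ∘ proj₂ ∘ ratio)
    pure (ρ , 0<ρ , λ k → ≤.trans (*-monoʳ-≤ (0≤b k) (ρ≤t k)) (proj₂ (proj₂ (ratio k))))

module SubsetCounting where
  open import Data.Vec using ([]; _∷_)
  open import Data.Bool using (_≟_)
  open import Data.Fin.Subset using (Side)
  open import Data.Fin.Subset.Properties using (∣p∣≤∣x∷p∣; ∣⁅x⁆∣≡1)
  open import Data.List using (List; []; _∷_; length)
  open import Data.List.Relation.Unary.All as All using (All; []; _∷_)
  open import Data.List.Relation.Unary.AllPairs using ([]; _∷_)
  open import Data.List.Relation.Unary.Unique.Propositional using (Unique)
  open import Data.Nat using (_≤_; _+_; z≤n; s≤s)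
  open import Data.Nat.Combinatorics using (_C_; nCn≡1; nCk+nC[k+1]≡[n+1]C[k+1])

  ∣p∪q∣≤∣p∣+∣q∣ : ∀ {n} (p q : Subset n) → ∣ p ∪ q ∣ ≤ ∣ p ∣ + ∣ q ∣
  ∣p∪q∣≤∣p∣+∣q∣ [] [] = z≤n
  ∣p∪q∣≤∣p∣+∣q∣ (outside ∷ p) (outside ∷ q) = ∣p∪q∣≤∣p∣+∣q∣ p q
  ∣p∪q∣≤∣p∣+∣q∣ (outside ∷ p) (inside ∷ q) =
    ℕ.≤-trans (s≤s (∣p∪q∣≤∣p∣+∣q∣ p q)) (ℕ.≤-reflexive (≡.sym (ℕ.+-suc ∣ p ∣ ∣ q ∣)))
  ∣p∪q∣≤∣p∣+∣q∣ (inside ∷ p) (y ∷ q) =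
    s≤s (ℕ.≤-trans (∣p∪q∣≤∣p∣+∣q∣ p q) (ℕ.+-monoʳ-≤ ∣ p ∣ (∣p∣≤∣x∷p∣ y q)))

  ∣⁅x⁆∪p∣≤1+∣p∣ : ∀ {n} (x : Fin n) (p : Subset n) → ∣ ⁅ x ⁆ ∪ p ∣ ≤ suc ∣ p ∣
  ∣⁅x⁆∪p∣≤1+∣p∣ x p =
    ℕ.≤-trans (∣p∪q∣≤∣p∣+∣q∣ ⁅ x ⁆ p) (ℕ.≤-reflexive (≡.cong (_+ ∣ p ∣) (∣⁅x⁆∣≡1 x)))

  nCk≤[1+n]Ck : ∀ n k → n C k ≤ suc n C k
  nCk≤[1+n]Ck n zero = ℕ.≤-refl
  nCk≤[1+n]Ck n (suc k) =
    ℕ.≤-trans (ℕ.m≤n+m (n C suc k) (n C k)) (ℕ.≤-reflexive (nCk+nC[k+1]≡[n+1]C[k+1] n k))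

  C-monoˡ-≤ : ∀ {m n} k → m ≤ n → m C k ≤ n C k
  C-monoˡ-≤ k m≤n = go (ℕ.≤⇒≤′ m≤n)
    where
    go : ∀ {m n} → m ℕ.≤′ n → m C k ≤ n C k
    go ℕ.≤′-refl = ℕ.≤-refl
    go (ℕ.≤′-step m≤′n) = ℕ.≤-trans (go m≤′n) (nCk≤[1+n]Ck _ k)

  tailsWith : ∀ {M} → Side → List (Subset (suc M)) → List (Subset M)
  tailsWith s [] = []
  tailsWith s ((t ∷ B) ∷ Bs) with t ≟ s
  ... | yes _ = B ∷ tailsWith s Bs
  ... | no _ = tailsWith s Bs

  length-tailsWith : ∀ {M} (Bs : List (Subset (suc M))) →
    length Bs ≡ length (tailsWith outside Bs) + length (tailsWith inside Bs)
  length-tailsWith [] = ≡.refl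
  length-tailsWith ((outside ∷ B) ∷ Bs) = ≡.cong suc (length-tailsWith Bs)
  length-tailsWith ((inside ∷ B) ∷ Bs) =
    ≡.trans (≡.cong suc (length-tailsWith Bs)) (≡.sym (ℕ.+-suc _ _))

  All-tailsWith : ∀ {M} {P : Subset (suc M) → Set} {Bs} s → All P Bs →
    All (λ B → P (s ∷ B)) (tailsWith s Bs)
  All-tailsWith s [] = []
  All-tailsWith {Bs = (t ∷ B) ∷ Bs} s (p ∷ ps) with t ≟ s
  ... | yes ≡.refl = p ∷ All-tailsWith s ps
  ... | no _ = All-tailsWith s ps

  Unique-tailsWith : ∀ {M} {Bs : List (Subset (suc M))} s → Unique Bs → Unique (tailsWith s Bs)
  Unique-tailsWith s [] = []
  Unique-tailsWith {Bs = (t ∷ B) ∷ Bs} s (B∉Bs ∷ unique) with t ≟ s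
  ... | yes ≡.refl = All.map (λ sB≢sB′ B≡B′ → sB≢sB′ (≡.cong (s ∷_) B≡B′)) (All-tailsWith s B∉Bs)
                     ∷ Unique-tailsWith s unique
  ... | no _ = Unique-tailsWith s unique

  count-small-subsets : ∀ M N {Bs : List (Subset M)} → Unique Bs → All (λ B → ∣ B ∣ ≤ N) Bs →
    length Bs ≤ (M + N) C N
  count-small-subsets zero N {[]} _ _ = z≤n
  count-small-subsets zero N {[] ∷ []} _ _ = ℕ.≤-reflexive (≡.sym (nCn≡1 N))
  count-small-subsets zero N {[] ∷ [] ∷ _} ((≢[] ∷ _) ∷ _) _ = contradiction ≡.refl ≢[]
  count-small-subsets (suc M) zero {Bs} unique small = begin
    length Bs                             ≡⟨ length-tailsWith Bs ⟩
    length outsides + length insides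
      ≡⟨ ≡.cong (length outsides +_) (no-insides (All-tailsWith inside small)) ⟩
    length outsides + 0                   ≡⟨ ℕ.+-identityʳ _ ⟩
    length outsides                       ≤⟨ count-small-subsets M zero (Unique-tailsWith outside unique)
                                                                    (All-tailsWith outside small) ⟩
    (M + 0) C 0                           ∎
    where
    open ℕ.≤-Reasoning
    outsides = tailsWith outside Bs
    insides = tailsWith inside Bs
    no-insides : ∀ {Bs} → All (λ B → suc ∣ B ∣ ≤ 0) Bs → length Bs ≡ 0
    no-insides [] = ≡.refl
  count-small-subsets (suc M) (suc N) {Bs} unique small = begin
    length Bs                                  ≡⟨ length-tailsWith Bs ⟩
    length outsides + length insides
      ≤⟨ ℕ.+-mono-≤
           (count-small-subsets M (suc N) (Unique-tailsWith outside unique) (All-tailsWith outside small))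
           (count-small-subsets M N (Unique-tailsWith inside unique)
                                    (All.map ℕ.s≤s⁻¹ (All-tailsWith inside small))) ⟩
    (M + suc N) C suc N + (M + N) C N          ≤⟨ ℕ.+-monoʳ-≤ _ (C-monoˡ-≤ N (ℕ.+-monoʳ-≤ M (ℕ.n≤1+n N))) ⟩
    (M + suc N) C suc N + (M + suc N) C N      ≡⟨ ℕ.+-comm ((M + suc N) C suc N) _ ⟩
    (M + suc N) C N + (M + suc N) C suc N      ≡⟨ nCk+nC[k+1]≡[n+1]C[k+1] (M + suc N) N ⟩
    (suc M + suc N) C suc N                    ∎
    where
    open ℕ.≤-Reasoning
    outsides = tailsWith outside Bs
    insides = tailsWith inside Bs

module LinearFunctionals (F : OrderedField) where
  open import Data.Vec.Functional using (Vector; _∷_; head; tail; replicate)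
  open import Data.Fin.Subset.Properties using (x∈p∪q⁺; x∈p∪q⁻; x∈⁅x⁆; x∈⁅y⁆⇒x≡y; ∉⊥; ∣⊥∣≡0)
  open import Data.Fin.Properties using (any?)
  open SubsetCounting using (∣⁅x⁆∪p∣≤1+∣p∣)
  open OrderedField F hiding (zero)
  open ℤ-RingSolver commutativeRing
  open import Relation.Binary.Reasoning.Setoid setoid

  record IsLinear {N} (φ : Vector Carrier N → Carrier) : Set where
    field
      cong   : ∀ {x y} → (∀ i → x i ≈ y i) → φ x ≈ φ y
      +-homo : ∀ x y → φ (λ i → x i + y i) ≈ φ x + φ y
      *-homo : ∀ a x → φ (λ i → a * x i) ≈ a * φ x

  linear-zero-dimensional : ∀ {φ : Vector Carrier 0 → Carrier} → IsLinear φ → ∀ x → φ x ≈ 0#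
  linear-zero-dimensional {φ} φ-linear x = begin
    φ x                ≈⟨ cong (λ ()) ⟩
    φ (λ i → 0# * x i) ≈⟨ *-homo 0# x ⟩
    0# * φ x           ≈⟨ zeroˡ (φ x) ⟩
    0#                 ∎
    where open IsLinear φ-linear

  linear-combination : ∀ {N} {φ χ : Vector Carrier N → Carrier} → IsLinear φ → IsLinear χ →
    ∀ c → IsLinear (λ x → φ x - c * χ x)
  linear-combination {φ = φ} {χ} φ-linear χ-linear c = record
    { cong = λ x≈y → +-cong (φ.cong x≈y) (-‿cong (*-congˡ (χ.cong x≈y)))
    ; +-homo = λ x y → trans (+-cong (φ.+-homo x y) (-‿cong (*-congˡ (χ.+-homo x y))))
        (solve 5 (λ c a b d e → (a :+ b) :- c :* (d :+ e) := (a :- c :* d) :+ (b :- c :* e))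
          refl c (φ x) (φ y) (χ x) (χ y))
    ; *-homo = λ a x → trans (+-cong (φ.*-homo a x) (-‿cong (*-congˡ (χ.*-homo a x))))
        (solve 4 (λ c a b d → a :* b :- c :* (a :* d) := a :* (b :- c :* d)) refl c a (φ x) (χ x))
    }
    where
    module φ = IsLinear φ-linear
    module χ = IsLinear χ-linear

  e₀ : ∀ {N} → Vector Carrier (suc N)
  e₀ {N} = 1# ∷ replicate N 0#

  module _ {N} {φ : Vector Carrier (suc N) → Carrier} (φ-linear : IsLinear φ) where
    open IsLinear φ-linear

    restriction-linear : IsLinear (λ y → φ (0# ∷ y))
    restriction-linear = record
      { cong = λ x≈y → cong λ { zero → refl ; (suc i) → x≈y i }
      ; +-homo = λ x y → trans (cong λ { zero → sym (+-identityˡ 0#) ; (suc i) → refl }) (+-homo _ _)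
      ; *-homo = λ a x → trans (cong λ { zero → sym (zeroʳ a) ; (suc i) → refl }) (*-homo _ _)
      }

    linear-split : ∀ x → φ x ≈ head x * φ e₀ + φ (0# ∷ tail x)
    linear-split x = begin
      φ x                                        ≈⟨ cong split ⟩
      φ (λ i → head x * e₀ i + (0# ∷ tail x) i)  ≈⟨ +-homo _ _ ⟩
      φ (λ i → head x * e₀ i) + φ (0# ∷ tail x)  ≈⟨ +-congʳ (*-homo _ _) ⟩
      head x * φ e₀ + φ (0# ∷ tail x)            ∎
      where
      split : ∀ i → x i ≈ head x * e₀ i + (0# ∷ tail x) i
      split zero = sym (trans (+-identityʳ _) (*-identityʳ _))
      split (suc i) = sym (trans (+-congʳ (zeroʳ (head x))) (+-identityˡ _))

    linear-restrict : φ e₀ ≈ 0# → ∀ x → φ x ≈ φ (0# ∷ tail x)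
    linear-restrict φe₀≈0 x = begin
      φ x                              ≈⟨ linear-split x ⟩
      head x * φ e₀ + φ (0# ∷ tail x)  ≈⟨ +-congʳ (trans (*-congˡ φe₀≈0) (zeroʳ (head x))) ⟩
      0# + φ (0# ∷ tail x)             ≈⟨ +-identityˡ _ ⟩
      φ (0# ∷ tail x)                  ∎

  module _ {N m : ℕ} where
    Spans : (Fin m → Vector Carrier N → Carrier) → (Fin m → Set) → Subset m → Set
    Spans φ A B = ∀ x → (∀ {k} → k ∈ B → φ k x ≈ 0#) → ∀ {k} → A k → φ k x ≈ 0#

    record KernelBasis (φ : Fin m → Vector Carrier N → Carrier) (A : Fin m → Set) (B : Subset m) : Set where
      field
        ⊆A    : ∀ {k} → k ∈ B → A k
        small : ∣ B ∣ ℕ.≤ N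
        spans : Spans φ A B

    spans-pivot : ∀ {φ A B} (c : Fin m → Carrier) {p} →
      Spans (λ k x → φ k x - c k * φ p x) A B → Spans φ A (⁅ p ⁆ ∪ B)
    spans-pivot {φ} c {p} spans x x∈ker {k} Ak = begin
      φ k x                                ≈⟨ solve 3 (λ a c b → a := (a :- c :* b) :+ c :* b) refl _ _ _ ⟩
      (φ k x - c k * φ p x) + c k * φ p x  ≈⟨ +-cong (spans x ψ-ker Ak) (*-congˡ φpx≈0) ⟩
      0# + c k * 0#                        ≈⟨ solve 1 (λ c → con 0ℤ :+ c :* con 0ℤ := con 0ℤ) refl _ ⟩
      0#                                   ∎
      where
      φpx≈0 : φ p x ≈ 0#
      φpx≈0 = x∈ker (x∈p∪q⁺ (inj₁ (x∈⁅x⁆ p)))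
      ψ-ker : ∀ {k} → k ∈ _ → φ k x - c k * φ p x ≈ 0#
      ψ-ker {k} k∈B = trans (+-cong (x∈ker (x∈p∪q⁺ (inj₂ k∈B))) (-‿cong (*-congˡ φpx≈0)))
        (solve 1 (λ c → con 0ℤ :- c :* con 0ℤ := con 0ℤ) refl (c k))

  basis-restriction : ∀ {N m} {φ : Fin m → Vector Carrier (suc N) → Carrier} {A B} →
    (∀ k → IsLinear (φ k)) → (∀ {k} → A k → φ k e₀ ≈ 0#) →
    KernelBasis (λ k y → φ k (0# ∷ y)) A B → KernelBasis φ A B
  basis-restriction {φ = φ} {A} φ-linear vanish basis = record
    { ⊆A = ⊆A
    ; small = ℕ.m≤n⇒m≤1+n small
    ; spans = λ x x∈ker {k} Ak → trans (restrict k Ak x)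
        (spans (tail x) (λ k∈B → trans (sym (restrict _ (⊆A k∈B) x)) (x∈ker k∈B)) Ak)
    }
    where
    open KernelBasis basis
    restrict : ∀ k → A k → ∀ x → φ k x ≈ φ k (0# ∷ tail x)
    restrict k Ak = linear-restrict (φ-linear k) (vanish Ak)

  module Pivot {N m : ℕ} {φ : Fin m → Vector Carrier (suc N) → Carrier} {A : Fin m → Set}
    (φ-linear : ∀ k → IsLinear (φ k)) {p} (Ap : A p) (φpe₀≉0 : ¬ φ p e₀ ≈ 0#) where
    u : Carrier
    u = proj₁ (inverse (φ p e₀) φpe₀≉0)

    c : Fin m → Carrier
    c k = φ k e₀ * u

    ψ : Fin m → Vector Carrier (suc N) → Carrier
    ψ k x = φ k x - c k * φ p x

    ψ-linear : ∀ k → IsLinear (ψ k)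
    ψ-linear k = linear-combination (φ-linear k) (φ-linear p) (c k)

    ψe₀≈0 : ∀ k → ψ k e₀ ≈ 0#
    ψe₀≈0 k = begin
      a - (a * u) * b
        ≈⟨ +-congˡ (-‿cong (solve 3 (λ a u b → (a :* u) :* b := a :* (b :* u)) refl a u b)) ⟩
      a - a * (b * u)
        ≈⟨ +-congˡ (-‿cong (trans (*-congˡ (proj₂ (inverse b φpe₀≉0))) (*-identityʳ a))) ⟩
      a - a             ≈⟨ -‿inverseʳ a ⟩
      0#                ∎
      where
      a = φ k e₀
      b = φ p e₀

    basis-pivot : ∀ {B} → KernelBasis (λ k y → ψ k (0# ∷ y)) A B → KernelBasis φ A (⁅ p ⁆ ∪ B)
    basis-pivot {B} basis = record
      { ⊆A = λ k∈pB → [ (λ k∈p → ≡.subst A (≡.sym (x∈⁅y⁆⇒x≡y p k∈p)) Ap) , ⊆A ]′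
                         (x∈p∪q⁻ ⁅ p ⁆ B k∈pB)
      ; small = ℕ.≤-trans (∣⁅x⁆∪p∣≤1+∣p∣ p B) (ℕ.s≤s small)
      ; spans = spans-pivot c (KernelBasis.spans (basis-restriction ψ-linear (λ {k} _ → ψe₀≈0 k) basis))
      }
      where open KernelBasis basis

  -- Gaussian elimination along the first coordinate; as ≈ is undecidable, the choice between
  -- a pivot and none is made under double negation.
  kernel-basis : ∀ {N m} (φ : Fin m → Vector Carrier N → Carrier) → (∀ k → IsLinear (φ k)) →
    (A : Fin m → Set) → ¬ ¬ ∃ (KernelBasis φ A)
  kernel-basis {zero} {m} φ φ-linear A = pure (⊥ , record
    { ⊆A = λ k∈⊥ → contradiction k∈⊥ ∉⊥
    ; small = ℕ.≤-reflexive (∣⊥∣≡0 m)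
    ; spans = λ x _ _ → linear-zero-dimensional (φ-linear _) x
    })
  kernel-basis {suc N} φ φ-linear A = do
    A? ← ¬¬-decide A
    φe₀≟0 ← ¬¬-decide (λ k → φ k e₀ ≈ 0#)
    extend φe₀≟0 (any? λ k → A? k ×-dec ¬? (φe₀≟0 k))
    where
    extend : (∀ k → Dec (φ k e₀ ≈ 0#)) → Dec (∃ λ k → A k × ¬ φ k e₀ ≈ 0#) →
      ¬ ¬ ∃ (KernelBasis φ A)
    extend _ (yes (p , Ap , φpe₀≉0)) = Product.map (⁅ p ⁆ ∪_) basis-pivot <$>
      kernel-basis (λ k y → ψ k (0# ∷ y)) (λ k → restriction-linear (ψ-linear k)) A
      where open Pivot {A = A} φ-linear Ap φpe₀≉0
    extend φe₀≟0 (no no-pivot) = Product.map₂ (basis-restriction φ-linear vanish) <$>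
      kernel-basis (λ k y → φ k (0# ∷ y)) (λ k → restriction-linear (φ-linear k)) A
      where
      vanish : ∀ {k} → A k → φ k e₀ ≈ 0#
      vanish {k} Ak = decidable-stable (φe₀≟0 k) λ φke₀≉0 → no-pivot (k , Ak , φke₀≉0)

module LocalPairs where
  open import Data.Vec using ([]; _∷_)
  open import Data.Fin.Subset using (Side)
  open import Data.Fin.Subset.Properties using (∩-idem; ∪-idem)
  open import Data.List using (List; []; _∷_; [_]; _++_; map; length)
  open import Data.List.Relation.Unary.All as All using (All)
  open import Data.List.Relation.Unary.All.Properties using (++⁺; ++⁻; map⁺; map⁻)
  import Data.List.Membership.Propositional as List
  open import Data.List.Membership.Propositional.Properties using (∈-map⁺; ∈-++⁺ˡ; ∈-++⁺ʳ)
  open import Data.List.Relation.Unary.Any using (here)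
  open import Data.List.Properties using (length-++; length-map)
  open import Data.Nat using (_≤_; _+_; _*_; _^_; z≤n)
  open import Data.Nat.Solver using (module +-*-Solver)
  open +-*-Solver using (solve; _:+_; _:*_; _:=_; con)

  Pair : ℕ → Set
  Pair n = Subset n × Subset n

  subsets : ∀ n → List (Subset n)
  subsets zero = [ [] ]
  subsets (suc n) = map (outside ∷_) (subsets n) ++ map (inside ∷_) (subsets n)

  ∈-subsets : ∀ {n} (A : Subset n) → A List.∈ subsets n
  ∈-subsets [] = here ≡.refl
  ∈-subsets (outside ∷ A) = ∈-++⁺ˡ (∈-map⁺ (outside ∷_) (∈-subsets A))
  ∈-subsets (inside ∷ A) = ∈-++⁺ʳ _ (∈-map⁺ (inside ∷_) (∈-subsets A))

  lift : ∀ {n} → Side → Pair n → Pair (suc n)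
  lift s (I , J) = s ∷ I , s ∷ J

  -- covers n lists the pairs (A, A ∪ {i}) with i ∉ A, and squares n the pairs
  -- (A ∪ {i}, A ∪ {j}) with i ≠ j and i, j ∉ A: the nonnegativity of their defects is
  -- the local form of supermodularity.
  covers : ∀ n → List (Pair n)
  covers zero = []
  covers (suc n) = map (lift outside) (covers n) ++ map (lift inside) (covers n) ++
                   map (λ A → outside ∷ A , inside ∷ A) (subsets n)

  squares : ∀ n → List (Pair n)
  squares zero = []
  squares (suc n) = map (lift outside) (squares n) ++ map (lift inside) (squares n) ++
                    map (λ (A , B) → inside ∷ A , outside ∷ B) (covers n)

  All-map-++³⁻ : ∀ {X Y Z B : Set} {P : B → Set} (f : X → B) (g : Y → B) (h : Z → B) xs ys zs →
    All P (map f xs ++ map g ys ++ map h zs) → All (P ∘ f) xs × All (P ∘ g) ys × All (P ∘ h) zs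
  All-map-++³⁻ f g h xs ys zs all with ++⁻ (map f xs) all
  ... | all-f , all-gh with ++⁻ (map g ys) all-gh
  ...   | all-g , all-h = map⁻ all-f , map⁻ all-g , map⁻ all-h

  Nested : ∀ {n} → Pair n → Set
  Nested (A , B) = A ∩ B ≡ A × A ∪ B ≡ B

  covers-nested : ∀ n → All Nested (covers n)
  covers-nested zero = All.[]
  covers-nested (suc n) =
    ++⁺ (map⁺ (All.map (lift-nested outside) (covers-nested n)))
        (++⁺ (map⁺ (All.map (lift-nested inside) (covers-nested n)))
             (map⁺ (All.universal adjacent-nested (subsets n))))
    where
    lift-nested : ∀ s {p : Pair n} → Nested p → Nested (lift s p)
    lift-nested outside (∩≡ , ∪≡) = ≡.cong (outside ∷_) ∩≡ , ≡.cong (outside ∷_) ∪≡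
    lift-nested inside (∩≡ , ∪≡) = ≡.cong (inside ∷_) ∩≡ , ≡.cong (inside ∷_) ∪≡
    adjacent-nested : ∀ (A : Subset n) → Nested (outside ∷ A , inside ∷ A)
    adjacent-nested A = ≡.cong (outside ∷_) (∩-idem A) , ≡.cong (inside ∷_) (∪-idem A)

  length-map-++³ : ∀ {X Y Z B : Set} (f : X → B) (g : Y → B) (h : Z → B) xs ys zs →
    length (map f xs ++ map g ys ++ map h zs) ≡ length xs + (length ys + length zs)
  length-map-++³ f g h xs ys zs = begin
    length (map f xs ++ map g ys ++ map h zs)             ≡⟨ length-++ (map f xs) ⟩
    length (map f xs) + length (map g ys ++ map h zs)     ≡⟨ ≡.cong (length (map f xs) +_) (length-++ (map g ys)) ⟩
    length (map f xs) + (length (map g ys) + length (map h zs))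
      ≡⟨ ≡.cong₂ _+_ (length-map f xs) (≡.cong₂ _+_ (length-map g ys) (length-map h zs)) ⟩
    length xs + (length ys + length zs)                   ∎
    where open ≡.≡-Reasoning

  length-subsets : ∀ n → length (subsets n) ≡ 2 ^ n
  length-subsets zero = ≡.refl
  length-subsets (suc n) = begin
    length (map (outside ∷_) (subsets n) ++ map (inside ∷_) (subsets n))
      ≡⟨ length-++ (map (outside ∷_) (subsets n)) ⟩
    length (map (outside ∷_) (subsets n)) + length (map (inside ∷_) (subsets n))
      ≡⟨ ≡.cong₂ _+_ (length-map (outside ∷_) (subsets n)) (length-map (inside ∷_) (subsets n)) ⟩
    length (subsets n) + length (subsets n)    ≡⟨ ≡.cong (λ k → k + k) (length-subsets n) ⟩
    2 ^ n + 2 ^ n                              ≡⟨ ≡.cong (2 ^ n +_) (ℕ.+-identityʳ (2 ^ n)) ⟨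
    2 ^ suc n                                  ∎
    where open ≡.≡-Reasoning

  length-covers : ∀ n → length (covers n) ≤ n * 2 ^ n
  length-covers zero = z≤n
  length-covers (suc n) = begin
    length (covers (suc n))
      ≡⟨ length-map-++³ (lift outside) (lift inside) _ (covers n) (covers n) (subsets n) ⟩
    c + (c + length (subsets n))        ≡⟨ ≡.cong (λ k → c + (c + k)) (length-subsets n) ⟩
    c + (c + X)                         ≤⟨ ℕ.+-mono-≤ (length-covers n) (ℕ.+-monoˡ-≤ X (length-covers n)) ⟩
    n * X + (n * X + X)                 ≤⟨ ℕ.m≤m+n _ X ⟩
    n * X + (n * X + X) + X             ≡⟨ solve 2 (λ n X → n :* X :+ (n :* X :+ X) :+ X
                                                          := (con 1 :+ n) :* (con 2 :* X)) ≡.refl n X ⟩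
    suc n * 2 ^ suc n                   ∎
    where
    open ℕ.≤-Reasoning
    c = length (covers n)
    X = 2 ^ n

  length-squares : ∀ n → length (squares (suc n)) + 2 ^ suc n ≤ suc n * suc n * 2 ^ suc n
  length-squares zero = ℕ.≤-refl
  length-squares (suc n) = begin
    length (squares (suc (suc n))) + 2 ^ suc (suc n)
      ≡⟨ ≡.cong (_+ 2 ^ suc (suc n)) (length-map-++³ (lift outside) (lift inside) _
                                                     (squares (suc n)) (squares (suc n)) (covers (suc n))) ⟩
    (q + (q + c)) + 2 * X
      ≡⟨ solve 3 (λ q c X → (q :+ (q :+ c)) :+ con 2 :* X := (q :+ X) :+ ((q :+ X) :+ c)) ≡.refl q c X ⟩
    (q + X) + ((q + X) + c)
      ≤⟨ ℕ.+-mono-≤ (length-squares n) (ℕ.+-mono-≤ (length-squares n) (length-covers (suc n))) ⟩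
    K + (K + suc n * X)                       ≤⟨ ℕ.m≤m+n _ (3 * suc n * X + 2 * X) ⟩
    K + (K + suc n * X) + (3 * suc n * X + 2 * X)
      ≡⟨ solve 2 (λ m X → m :* m :* X :+ (m :* m :* X :+ m :* X) :+ (con 3 :* m :* X :+ con 2 :* X)
                           := (con 1 :+ m) :* (con 1 :+ m) :* (con 2 :* X)) ≡.refl (suc n) X ⟩
    suc (suc n) * suc (suc n) * 2 ^ suc (suc n) ∎
    where
    open ℕ.≤-Reasoning
    q = length (squares (suc n))
    c = length (covers (suc n))
    X = 2 ^ suc n
    K = suc n * suc n * X

module LocalSupermodularity (F : OrderedField) where
  open OrderedField F hiding (zero)
  open OrderedFieldProperties F
  open ℤ-RingSolver commutativeRing
  open LocalPairs
  open import Data.Vec as Vec using ([]; _∷_)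
  open import Data.Fin.Subset using (_⊆_)
  open import Data.Fin.Subset.Properties using (drop-∷-⊆; p⊆p∪q; q⊆p∪q)
  open import Data.List.Relation.Unary.All as All using (All)
  private module ≤ = IsTotalOrder ≤-isTotalOrder

  defect : ∀ {n} → SetFun F n → Pair n → Carrier
  defect f (I , J) = (f (I ∩ J) + f (I ∪ J)) - (f I + f J)

  defect-cong : ∀ {n} {f g : SetFun F n} → (∀ X → f X ≈ g X) → ∀ p → defect f p ≈ defect g p
  defect-cong f≈g _ = +-cong (+-cong (f≈g _) (f≈g _)) (-‿cong (+-cong (f≈g _) (f≈g _)))

  defect-+ : ∀ {n} (f g : SetFun F n) p → defect (λ X → f X + g X) p ≈ defect f p + defect g p
  defect-+ f g (I , J) = solve 8 (λ a b c d a′ b′ c′ d′ →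
      ((a :+ a′) :+ (b :+ b′)) :- ((c :+ c′) :+ (d :+ d′))
        := ((a :+ b) :- (c :+ d)) :+ ((a′ :+ b′) :- (c′ :+ d′)))
    refl (f (I ∩ J)) (f (I ∪ J)) (f I) (f J) (g (I ∩ J)) (g (I ∪ J)) (g I) (g J)

  defect-* : ∀ {n} (c : Carrier) (f : SetFun F n) p → defect (λ X → c * f X) p ≈ c * defect f p
  defect-* c f (I , J) =
    solve 5 (λ c a b d e → (c :* a :+ c :* b) :- (c :* d :+ c :* e) := c :* ((a :+ b) :- (d :+ e)))
      refl c (f (I ∩ J)) (f (I ∪ J)) (f I) (f J)

  defect-combination : ∀ {n} (f g : SetFun F n) (c : Carrier) p →
    defect (λ X → f X - c * g X) p ≈ defect f p - c * defect g p
  defect-combination f g c (I , J) = solve 9 (λ c a b d e a′ b′ d′ e′ →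
      ((a :- c :* a′) :+ (b :- c :* b′)) :- ((d :- c :* d′) :+ (e :- c :* e′))
        := ((a :+ b) :- (d :+ e)) :- c :* ((a′ :+ b′) :- (d′ :+ e′)))
    refl c (f (I ∩ J)) (f (I ∪ J)) (f I) (f J) (g (I ∩ J)) (g (I ∪ J)) (g I) (g J)

  supermodular⇒defect-nonneg : ∀ {n} {f : SetFun F n} → Supermodular F f → ∀ p → 0# ≤ defect f p
  supermodular⇒defect-nonneg f-super (I , J) = x≤y⇒0≤y-x (f-super I J)

  monotone-from-covers : ∀ {n} (d : SetFun F n) → All (λ (A , B) → d A ≤ d B) (covers n) →
    ∀ {A C} → A ⊆ C → d A ≤ d C
  monotone-from-covers {zero} d _ {[]} {[]} _ = ≤.refl
  monotone-from-covers {suc n} d mono {x ∷ A} {y ∷ C} A⊆C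
    with All-map-++³⁻ (lift outside) (lift inside) _ (covers n) (covers n) (subsets n) mono
  ... | mono₀ , mono₁ , mono₀₁ with x | y
  ...   | outside | outside = monotone-from-covers (d ∘ (outside ∷_)) mono₀ (drop-∷-⊆ A⊆C)
  ...   | inside  | inside  = monotone-from-covers (d ∘ (inside ∷_)) mono₁ (drop-∷-⊆ A⊆C)
  ...   | outside | inside  = ≤.trans (monotone-from-covers (d ∘ (outside ∷_)) mono₀ (drop-∷-⊆ A⊆C))
                                      (All.lookup mono₀₁ (∈-subsets C))
  ...   | inside  | outside with () ← A⊆C Vec.here

  ∂ : ∀ {n} → SetFun F (suc n) → SetFun F n
  ∂ f X = f (inside ∷ X) - f (outside ∷ X)

  crossed-defect : ∀ {n} (f : SetFun F (suc n)) {A B} → Nested (A , B) →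
    defect f (inside ∷ A , outside ∷ B) ≈ ∂ f B - ∂ f A
  crossed-defect f {A} {B} (∩≡ , ∪≡) rewrite ∩≡ | ∪≡ =
    solve 4 (λ a b c e → (a :+ b) :- (c :+ e) := (b :- e) :- (c :- a)) refl
      (f (outside ∷ A)) (f (inside ∷ B)) (f (inside ∷ A)) (f (outside ∷ B))

  ∂-monotone : ∀ {n} (f : SetFun F (suc n)) →
    All (λ (A , B) → 0# ≤ defect f (inside ∷ A , outside ∷ B)) (covers n) →
    ∀ {A C} → A ⊆ C → ∂ f A ≤ ∂ f C
  ∂-monotone {n} f crossed = monotone-from-covers (∂ f) (All.zipWith
    (λ (0≤defect , nested) → 0≤y-x⇒x≤y (≤-respˡʳ-≈ refl (crossed-defect f nested) 0≤defect))
    (crossed , covers-nested n))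

  supermodular-from-squares : ∀ {n} (f : SetFun F n) → All (λ p → 0# ≤ defect f p) (squares n) →
    Supermodular F f
  supermodular-from-squares {zero} f _ [] [] = ≤.refl
  supermodular-from-squares {suc n} f local (x ∷ I) (y ∷ J)
    with All-map-++³⁻ (lift outside) (lift inside) _ (squares n) (squares n) (covers n) local
  ... | local₀ , local₁ , crossed with x | y
  ...   | outside | outside = supermodular-from-squares (f ∘ (outside ∷_)) local₀ I J
  ...   | inside  | inside  = supermodular-from-squares (f ∘ (inside ∷_)) local₁ I J
  ...   | inside  | outside = ≤-exchange (supermodular-from-squares (f ∘ (outside ∷_)) local₀ I J)
                                         (∂-monotone f crossed (p⊆p∪q J))
  ...   | outside | inside  = ≤-respˡʳ-≈ (+-comm _ _) refl
    (≤-exchange (≤-respˡʳ-≈ (+-comm _ _) refl (supermodular-from-squares (f ∘ (outside ∷_)) local₀ I J))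
                (∂-monotone f crossed (q⊆p∪q I J)))

module Irreducibility (F : OrderedField) where
  open OrderedField F hiding (zero)
  open OrderedFieldProperties F
  open ℤ-RingSolver commutativeRing
  open import Relation.Binary.Reasoning.Setoid setoid

  modular-scale : ∀ {n} {h k : SetFun F n} (a : Carrier) → Modular F h → (∀ X → k X ≈ a * h X) →
    Modular F k
  modular-scale {h = h} {k} a h-modular k≈ah I J = begin
    k (I ∩ J) + k (I ∪ J)          ≈⟨ +-cong (k≈ah _) (k≈ah _) ⟩
    a * h (I ∩ J) + a * h (I ∪ J)  ≈⟨ distribˡ a _ _ ⟨
    a * (h (I ∩ J) + h (I ∪ J))    ≈⟨ *-congˡ (h-modular I J) ⟩
    a * (h I + h J)                ≈⟨ distribˡ a _ _ ⟩
    a * h I + a * h J              ≈⟨ +-cong (k≈ah _) (k≈ah _) ⟨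
    k I + k J                      ∎

  supermodular-scale : ∀ {n} {g : SetFun F n} {c} → 0# ≤ c → Supermodular F g →
    Supermodular F (λ X → c * g X)
  supermodular-scale {g = g} {c} 0≤c g-super I J =
    ≤-respˡʳ-≈ (trans (*-comm _ c) (distribˡ c _ _)) (trans (*-comm _ c) (distribˡ c _ _))
      (*-monoʳ-≤ 0≤c (g-super I J))

  identified-if-dominates : ∀ {n} {f g : SetFun F n} {ρ} → Irreducible F f → ¬ Modular F g →
    Supermodular F g → 0# < ρ → Supermodular F (λ X → f X - ρ * g X) → Identified F f g
  identified-if-dominates {f = f} {g} {ρ} (_ , _ , f-irreducible) g-nonmodular g-super 0<ρ rest-super
    with f-irreducible (λ X → f X - ρ * g X) (λ X → ρ * g X) rest-super
           (supermodular-scale (proj₁ 0<ρ) g-super)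
           (λ X → solve 3 (λ a r b → a := (a :- r :* b) :+ r :* b) refl (f X) ρ (g X))
  ... | _ , c , 0≤c , ρg-cf-modular =
    c * ρ⁻¹ , *-pos (0≤c , c≉0) (inverse-pos 0<ρ ρρ⁻¹≈1) ,
    modular-scale ρ⁻¹ ρg-cf-modular (λ X → sym (rescale X))
    where
    ρ⁻¹ = proj₁ (inverse ρ (0<x⇒x≉0 0<ρ))
    ρρ⁻¹≈1 = proj₂ (inverse ρ (0<x⇒x≉0 0<ρ))
    rescale : ∀ X → ρ⁻¹ * (ρ * g X - c * f X) ≈ g X - (c * ρ⁻¹) * f X
    rescale X = begin
      ρ⁻¹ * (ρ * g X - c * f X)
        ≈⟨ solve 5 (λ r′ r G c Fx → r′ :* (r :* G :- c :* Fx) := (r :* r′) :* G :- (c :* r′) :* Fx)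
             refl ρ⁻¹ ρ (g X) c (f X) ⟩
      (ρ * ρ⁻¹) * g X - (c * ρ⁻¹) * f X  ≈⟨ +-congʳ (trans (*-congʳ ρρ⁻¹≈1) (*-identityˡ (g X))) ⟩
      g X - (c * ρ⁻¹) * f X              ∎
    c≉0 : ¬ 0# ≈ c
    c≉0 0≈c = g-nonmodular (modular-scale ρ⁻¹ ρg-cf-modular λ X → begin
      g X                       ≈⟨ solve 2 (λ G Fx → G := G :- con 0ℤ :* Fx) refl (g X) (f X) ⟩
      g X - 0# * f X            ≈⟨ +-congˡ (-‿cong (*-congʳ (trans (sym (zeroˡ ρ⁻¹)) (*-congʳ 0≈c)))) ⟩
      g X - (c * ρ⁻¹) * f X     ≈⟨ rescale X ⟨
      ρ⁻¹ * (ρ * g X - c * f X) ∎)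

module TightConstraints (F : OrderedField) (n : ℕ) where
  open OrderedField F hiding (zero)
  open OrderedFieldProperties F
  open LinearFunctionals F
  open LocalPairs
  open LocalSupermodularity F
  open Irreducibility F
  open import Data.Vec.Functional using (Vector)
  open import Data.List using (List; length; lookup)
  open import Data.List.Relation.Unary.All as All using (All)
  open import Data.List.Relation.Unary.AllPairs using (AllPairs)
  open import Data.List.Relation.Unary.Any using (index)
  open import Data.List.Relation.Unary.Any.Properties using (lookup-index)
  open import Data.List.Relation.Binary.Pointwise using (Pointwise-length)
  open import Data.Nat.Combinatorics using (_C_)
  open SubsetCounting using (count-small-subsets)

  N : ℕ
  N = length (subsets n)

  m : ℕ
  m = length (squares n)

  square : Fin m → Pair n
  square = lookup (squares n)

  Tight : SetFun F n → Fin m → Set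
  Tight f k = defect f (square k) ≈ 0#

  coordinate : Subset n → Fin N
  coordinate A = index (∈-subsets A)

  square-defect : Fin m → Vector Carrier N → Carrier
  square-defect k x = defect (x ∘ coordinate) (square k)

  square-defect-linear : ∀ k → IsLinear (square-defect k)
  square-defect-linear k = record
    { cong = λ x≈y → defect-cong (x≈y ∘ coordinate) (square k)
    ; +-homo = λ x y → defect-+ (x ∘ coordinate) (y ∘ coordinate) (square k)
    ; *-homo = λ a x → defect-* a (x ∘ coordinate) (square k)
    }

  square-defect-coordinates : ∀ h k → square-defect k (h ∘ lookup (subsets n)) ≈ defect h (square k)
  square-defect-coordinates h k =
    defect-cong (λ A → reflexive (≡.cong h (≡.sym (lookup-index (∈-subsets A))))) (square k)

  Basis : SetFun F n → Subset m → Set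
  Basis f = KernelBasis square-defect (Tight f)

  basis-spans : ∀ f h {B} → Basis f B → (∀ {k} → k ∈ B → Tight h k) → ∀ {k} → Tight f k → Tight h k
  basis-spans f h basis h-tight {k} f-tight =
    trans (sym (square-defect-coordinates h k))
      (KernelBasis.spans basis (h ∘ lookup (subsets n))
        (λ {k′} k′∈B → trans (square-defect-coordinates h k′) (h-tight k′∈B)) f-tight)

  same-basis⇒identified : ∀ {f g B} → Irreducible F f → Irreducible F g → Basis f B → Basis g B →
    ¬ ¬ Identified F f g
  same-basis⇒identified {f} {g} f-irreducible@(f-super , _) (g-super , g-nonmodular , _)
                        f-basis g-basis = do
    (ρ , 0<ρ , ρg≤f) ← ¬¬-common-ratio-below (defect f ∘ square) (defect g ∘ square)
      (supermodular⇒defect-nonneg f-super ∘ square) (supermodular⇒defect-nonneg g-super ∘ square)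
      (λ k → basis-spans f g f-basis (KernelBasis.⊆A g-basis))
    let rest : SetFun F n
        rest X = f X - ρ * g X
        rest-nonneg : ∀ k → 0# ≤ defect rest (square k)
        rest-nonneg k =
          ≤-respˡʳ-≈ refl (sym (defect-combination f g ρ (square k))) (x≤y⇒0≤y-x (ρg≤f k))
    pure (identified-if-dominates f-irreducible g-nonmodular g-super 0<ρ
      (supermodular-from-squares rest (All.tabulate λ p∈ →
        ≡.subst (λ p → 0# ≤ defect rest p) (≡.sym (lookup-index p∈)) (rest-nonneg (index p∈)))))

  count-irreducible : (L : List (SetFun F n)) → All (Irreducible F) L →
    AllPairs (λ f g → ¬ Identified F f g) L → length L ℕ.≤ (m ℕ.+ N) C N
  count-irreducible L irreducible distinct = decidable-stable (length L ℕ.≤? (m ℕ.+ N) C N) do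
    (Bs , bases) ← ¬¬-Pointwise (λ {f} f-irreducible →
      Product.map₂ (f-irreducible ,_) <$> kernel-basis square-defect square-defect-linear (Tight f))
      irreducible
    pure (begin
      length L      ≡⟨ Pointwise-length bases ⟩
      length Bs     ≤⟨ count-small-subsets m N (Pointwise-unique same-basis distinct bases)
                                               (Pointwise⇒All (KernelBasis.small ∘ proj₂) bases) ⟩
      (m ℕ.+ N) C N ∎)
    where
    open ℕ.≤-Reasoning
    same-basis : ∀ {f g B} → Irreducible F f × Basis f B → Irreducible F g × Basis g B →
      ¬ ¬ Identified F f g
    same-basis (f-irreducible , f-basis) (g-irreducible , g-basis) =
      same-basis⇒identified f-irreducible g-irreducible f-basis g-basis

open import Data.Nat using (_≤_; _*_; _^_)
open import Data.Nat.Combinatorics using (_C_)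
open import Data.List using (List; length)
open import Data.List.Relation.Unary.All using (All)
open import Data.List.Relation.Unary.AllPairs using (AllPairs)

theorem5p1 : (F : OrderedField) (n : ℕ) → 1 ≤ n →
    (L : List (SetFun F n)) →
    All (Irreducible F) L →
    AllPairs (λ f g → ¬ Identified F f g) L →
    length L ≤ (n * n * 2 ^ n) C (2 ^ n)
theorem5p1 F (suc n) _ L irreducible distinct = begin
  length L                                ≤⟨ count-irreducible L irreducible distinct ⟩
  (m ℕ.+ N) C N                           ≡⟨ ≡.cong (λ k → (m ℕ.+ k) C k) (length-subsets (suc n)) ⟩
  (m ℕ.+ 2 ^ suc n) C 2 ^ suc n           ≤⟨ C-monoˡ-≤ (2 ^ suc n) (length-squares n) ⟩
  (suc n * suc n * 2 ^ suc n) C 2 ^ suc n ∎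
  where
  open ℕ.≤-Reasoning
  open TightConstraints F (suc n) using (m; N; count-irreducible)
  open LocalPairs using (length-subsets; length-squares)
  open SubsetCounting using (C-monoˡ-≤)
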